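{- For all conditional propositions $X,Y$ and every finite (possibly empty) sequence $\Gamma$: if $\vDash\lfloor\Gamma|X|\neg X\rfloor$ then $\vDash\lfloor\Gamma|[X]Y\leftrightarrow Y\rfloor$. In particular $\vDash\lfloor[\top]Y\leftrightarrow Y\rfloor$ and $\vDash\lfloor[\bot]Y\leftrightarrow Y\rfloor$.
   Context: $\mathcal{C}$: smallest set containing $\bot$ and a set of atoms, closed under $X\to Y$ and $[X]Y$; $\neg X:=X\to\bot$, $X\vee Y:=\neg X\to Y$, $X\wedge Y:=\neg(\neg X\vee\neg Y)$, $\top:=\neg\bot$, $X\leftrightarrow Y:=(X\to Y)\wedge(Y\to X)$. A Bayesian algebra is a Boolean algebra $(E,\cap,\cup,\sim,\bot,\top)$ with $[\;]:E\times E\to E$ such that for all $x,y$: $z\mapsto[x]z$ is a Boolean automorphism; $x\subset y$ implies $[x]y=\top$ or $x=\bot$; $x\cap[x]y=x\cap y$; $[x][x]y=[\sim x][x]y=[x]y$. A valuation in $E$ is $H:\mathcal{C}\to E$ with $H(\bot)=\bot$, $H(X\to Y)=\sim H(X)\cup H(Y)$, $H([X]Y)=[H(X)]H(Y)$. For $X_1,\dots,X_n\in\mathcal{C}$, $\vDash\lfloor X_1|\cdots|X_n\rfloor$ means: for every Bayesian algebra $E$ and every valuation $H$ in $E$ there is $i$ with $H(X_i)=\top$. -}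

module Defs where

open import Level using (Level; _⊔_) renaming (suc to lsuc)
open import Data.Product using (Σ; _×_; ∃)
open import Data.Sum using (_⊎_)
open import Data.List using (List; []; _∷_)
open import Data.List.Relation.Unary.Any using (Any)
open import Algebra.Lattice.Bundles using (BooleanAlgebra)

data Cond (Atom : Set) : Set where
  atom : Atom → Cond Atom
  ⊥c   : Cond Atom
  _⇒_  : Cond Atom → Cond Atom → Cond Atom
  [_]_ : Cond Atom → Cond Atom → Cond Atom

infixr 5 _⇒_
infixr 6 [_]_

module _ {Atom : Set} where
  ¬c_ : Cond Atom → Cond Atom
  ¬c X = X ⇒ ⊥c

  _∨c_ : Cond Atom → Cond Atom → Cond Atom
  X ∨c Y = (¬c X) ⇒ Y

  _∧c_ : Cond Atom → Cond Atom → Cond Atom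
  X ∧c Y = ¬c ((¬c X) ∨c (¬c Y))

  ⊤c : Cond Atom
  ⊤c = ¬c ⊥c

  _⇔c_ : Cond Atom → Cond Atom → Cond Atom
  X ⇔c Y = (X ⇒ Y) ∧c (Y ⇒ X)

record BayesianAlgebra (c ℓ : Level) : Set (lsuc (c ⊔ ℓ)) where
  field
    booleanAlgebra : BooleanAlgebra c ℓ
  open BooleanAlgebra booleanAlgebra public
  field
    cond : Carrier → Carrier → Carrier
    cond-cong : ∀ {x x' y y'} → x ≈ x' → y ≈ y' → cond x y ≈ cond x' y'
    -- z ↦ [x]z is a Boolean automorphism
    auto-∧ : ∀ x y z → cond x (y ∧ z) ≈ (cond x y ∧ cond x z)
    auto-∨ : ∀ x y z → cond x (y ∨ z) ≈ (cond x y ∨ cond x z)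
    auto-¬ : ∀ x y → cond x (¬ y) ≈ ¬ (cond x y)
    auto-⊤ : ∀ x → cond x ⊤ ≈ ⊤
    auto-⊥ : ∀ x → cond x ⊥ ≈ ⊥
    auto-injective : ∀ x y z → cond x y ≈ cond x z → y ≈ z
    auto-surjective : ∀ x w → Σ Carrier (λ z → cond x z ≈ w)
    incl : ∀ x y → (x ∧ y) ≈ x → (cond x y ≈ ⊤) ⊎ (x ≈ ⊥)
    meet : ∀ x y → (x ∧ cond x y) ≈ (x ∧ y)
    idem : ∀ x y → cond x (cond x y) ≈ cond x y
    compl : ∀ x y → cond (¬ x) (cond x y) ≈ cond x y

module _ {c ℓ : Level} (E : BayesianAlgebra c ℓ) {Atom : Set} where
  open BayesianAlgebra E

  IsValuation : (Cond Atom → Carrier) → Set ℓ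
  IsValuation H =
      (H ⊥c ≈ ⊥)
    × (∀ X Y → H (X ⇒ Y) ≈ (¬ H X ∨ H Y))
    × (∀ X Y → H ([ X ] Y) ≈ cond (H X) (H Y))

-- ⊨ ⌊X₁|⋯|Xₙ⌋ : for every Bayesian algebra (at levels c, ℓ) and every
-- valuation H in it, some Xᵢ is sent to ⊤.
⊨_at_,_ : {Atom : Set} → List (Cond Atom) → (c ℓ : Level) → Set (lsuc (c ⊔ ℓ))
⊨_at_,_ {Atom} Γ c ℓ =
  (E : BayesianAlgebra c ℓ) (H : Cond Atom → BayesianAlgebra.Carrier E) →
  IsValuation E H →
  Any (λ X → BayesianAlgebra._≈_ E (H X) (BayesianAlgebra.⊤ E)) Γ

module Submission where

-- Conditioning on a trivial event changes nothing.
--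
-- In a Bayesian algebra, [x]y ≈ y whenever x is ⊤ or ⊥: for x ≈ ⊤ the
-- axiom x ∩ [x]y = x ∩ y reads [x]y = y directly, and for x ≈ ⊥ = ∼⊤ the
-- axiom [∼x][x]y = [x]y, applied at x = ⊤, gives [⊥]y = [⊥][⊤]y = [⊤]y = y.
--
-- The theorem follows: a valuation satisfying one of Γ keeps doing so, one
-- with H(X) = ⊤ or H(¬X) = ⊤ (i.e. H(X) = ⊥) satisfies [X]Y ↔ Y, and the
-- special cases are X = ⊤ (as ¬⊥) and X = ⊥.

open import Defs
open import Level using (Level)
open import Data.List using (List; []; _∷_; _++_)
open import Data.Product using (_×_; _,_)
open import Data.Sum using (_⊎_; inj₁; inj₂)
open import Data.List.Relation.Unary.Any using (here; there)
open import Data.List.Relation.Unary.Any.Properties using (++⁺ˡ; ++⁺ʳ; ++⁻)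
import Algebra.Lattice.Properties.BooleanAlgebra as BooleanAlgebraProperties
import Relation.Binary.Reasoning.Setoid as SetoidReasoning

module Conditioning {c ℓ : Level} (E : BayesianAlgebra c ℓ) where
  open BayesianAlgebra E
  open BooleanAlgebraProperties booleanAlgebra
  open SetoidReasoning setoid

  Trivial : Carrier → Set ℓ
  Trivial x = (x ≈ ⊤) ⊎ (x ≈ ⊥)

  cond-⊤ : ∀ {x} y → x ≈ ⊤ → cond x y ≈ y
  cond-⊤ {x} y x≈⊤ = begin
    cond x y      ≈⟨ sym (∧-identityˡ _) ⟩
    ⊤ ∧ cond x y  ≈⟨ ∧-congʳ (sym x≈⊤) ⟩
    x ∧ cond x y  ≈⟨ meet x y ⟩
    x ∧ y         ≈⟨ ∧-congʳ x≈⊤ ⟩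
    ⊤ ∧ y         ≈⟨ ∧-identityˡ _ ⟩
    y             ∎

  -- Conditioning on the impossible event ⊥ = ∼⊤ is the identity as well,
  -- by the axiom [∼x][x]y = [x]y at x = ⊤.
  cond-⊥ : ∀ {x} y → x ≈ ⊥ → cond x y ≈ y
  cond-⊥ {x} y x≈⊥ = begin
    cond x y               ≈⟨ cond-cong (trans x≈⊥ (sym ¬⊤≈⊥)) (sym (cond-⊤ y refl)) ⟩
    cond (¬ ⊤) (cond ⊤ y)  ≈⟨ compl ⊤ y ⟩
    cond ⊤ y               ≈⟨ cond-⊤ y refl ⟩
    y                      ∎

  cond-trivial : ∀ {x} y → Trivial x → cond x y ≈ y
  cond-trivial y (inj₁ x≈⊤) = cond-⊤ y x≈⊤
  cond-trivial y (inj₂ x≈⊥) = cond-⊥ y x≈⊥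

module Valuation {c ℓ : Level} (E : BayesianAlgebra c ℓ) {Atom : Set}
                 (H : Cond Atom → BayesianAlgebra.Carrier E) (isValuation : IsValuation E H) where
  open BayesianAlgebra E
  open BooleanAlgebraProperties booleanAlgebra
  open SetoidReasoning setoid
  open Conditioning E

  H-⊥ : H ⊥c ≈ ⊥
  H-⊥ = let (h , _ , _) = isValuation in h

  H-⇒ : ∀ A B → H (A ⇒ B) ≈ (¬ H A ∨ H B)
  H-⇒ = let (_ , h , _) = isValuation in h

  H-[] : ∀ A B → H ([ A ] B) ≈ cond (H A) (H B)
  H-[] = let (_ , _ , h) = isValuation in h

  H-¬ : ∀ A → H (¬c A) ≈ ¬ H A
  H-¬ A = begin
    H (A ⇒ ⊥c)   ≈⟨ H-⇒ A ⊥c ⟩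
    ¬ H A ∨ H ⊥c ≈⟨ ∨-congˡ H-⊥ ⟩
    ¬ H A ∨ ⊥    ≈⟨ ∨-identityʳ _ ⟩
    ¬ H A        ∎

  H-⊤ : H ⊤c ≈ ⊤
  H-⊤ = trans (H-¬ ⊥c) (trans (¬-cong H-⊥) ¬⊥≈⊤)

  H-∧ : ∀ A B → H (A ∧c B) ≈ (H A ∧ H B)
  H-∧ A B = begin
    H (¬c (¬c (¬c A) ⇒ ¬c B))            ≈⟨ H-¬ _ ⟩
    ¬ H (¬c (¬c A) ⇒ ¬c B)               ≈⟨ ¬-cong (H-⇒ _ _) ⟩
    ¬ (¬ H (¬c (¬c A)) ∨ H (¬c B))       ≈⟨ ¬-cong (∨-cong (¬-cong ¬¬A) (H-¬ B)) ⟩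
    ¬ (¬ H A ∨ ¬ H B)                    ≈⟨ ¬-cong (sym (deMorgan₁ _ _)) ⟩
    ¬ ¬ (H A ∧ H B)                      ≈⟨ ¬-involutive _ ⟩
    H A ∧ H B                            ∎
    where
    ¬¬A : H (¬c (¬c A)) ≈ H A
    ¬¬A = trans (H-¬ _) (trans (¬-cong (H-¬ A)) (¬-involutive _))

  H-⇒-refl : ∀ A B → H A ≈ H B → H (A ⇒ B) ≈ ⊤
  H-⇒-refl A B HA≈HB = trans (H-⇒ A B) (trans (∨-congˡ (sym HA≈HB)) (∨-complementˡ _))

  H-⇔-refl : ∀ A B → H A ≈ H B → H (A ⇔c B) ≈ ⊤
  H-⇔-refl A B HA≈HB = begin
    H (A ⇔c B)                    ≈⟨ H-∧ _ _ ⟩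
    H (A ⇒ B) ∧ H (B ⇒ A)         ≈⟨ ∧-cong (H-⇒-refl A B HA≈HB) (H-⇒-refl B A (sym HA≈HB)) ⟩
    ⊤ ∧ ⊤                         ≈⟨ ∧-identityʳ _ ⟩
    ⊤                             ∎

  H-¬-⊤ : ∀ A → H (¬c A) ≈ ⊤ → H A ≈ ⊥
  H-¬-⊤ A H¬A≈⊤ = begin
    H A        ≈⟨ sym (¬-involutive _) ⟩
    ¬ ¬ H A    ≈⟨ ¬-cong (sym (H-¬ A)) ⟩
    ¬ H (¬c A) ≈⟨ ¬-cong H¬A≈⊤ ⟩
    ¬ ⊤        ≈⟨ ¬⊤≈⊥ ⟩
    ⊥          ∎

  cond-trivial-⇔ : ∀ X Y → Trivial (H X) → H (([ X ] Y) ⇔c Y) ≈ ⊤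
  cond-trivial-⇔ X Y trivial = H-⇔-refl _ _ (trans (H-[] X Y) (cond-trivial (H Y) trivial))

mainTheorem12 : {Atom : Set} (c ℓ : Level) (X Y : Cond Atom) (Γ : List (Cond Atom)) →
    ((⊨ Γ ++ (X ∷ (¬c X) ∷ []) at c , ℓ) → (⊨ Γ ++ ((([ X ] Y) ⇔c Y) ∷ []) at c , ℓ))
    × (⊨ ((([ ⊤c ] Y) ⇔c Y) ∷ []) at c , ℓ)
    × (⊨ ((([ ⊥c ] Y) ⇔c Y) ∷ []) at c , ℓ)
mainTheorem12 c ℓ X Y Γ = from-excluded-middle , conditioning-on-⊤ , conditioning-on-⊥
  where
  open Valuation

  from-excluded-middle : (⊨ Γ ++ (X ∷ (¬c X) ∷ []) at c , ℓ) →
                         (⊨ Γ ++ ((([ X ] Y) ⇔c Y) ∷ []) at c , ℓ)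
  from-excluded-middle valid E H v with ++⁻ Γ (valid E H v)
  ... | inj₁ inΓ                   = ++⁺ˡ inΓ
  ... | inj₂ (here HX≈⊤)           = ++⁺ʳ Γ (here (cond-trivial-⇔ E H v X Y (inj₁ HX≈⊤)))
  ... | inj₂ (there (here H¬X≈⊤))  = ++⁺ʳ Γ (here (cond-trivial-⇔ E H v X Y (inj₂ (H-¬-⊤ E H v X H¬X≈⊤))))
  ... | inj₂ (there (there ()))

  conditioning-on-⊤ : ⊨ ((([ ⊤c ] Y) ⇔c Y) ∷ []) at c , ℓ
  conditioning-on-⊤ E H v = here (cond-trivial-⇔ E H v ⊤c Y (inj₁ (H-⊤ E H v)))

  conditioning-on-⊥ : ⊨ ((([ ⊥c ] Y) ⇔c Y) ∷ []) at c , ℓ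
  conditioning-on-⊥ E H v = here (cond-trivial-⇔ E H v ⊥c Y (inj₂ (H-⊥ E H v)))
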